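{- Fix $k\in\mathbb{N}$ and a cycle structure $x$ of some element of $S_\infty$. Then there is $b_x\in\mathbb{N}$ such that for every finite group $G$ of cyclicity level $k$ and every injective homomorphism $\phi:G\hookrightarrow S_\infty$, there are at most $b_x$ elements with cycle structure $x$ in $\phi(G)$.
   Context: $S_\infty$ is the group of permutations of $\mathbb{N}$ fixing all but finitely many elements. The cycle structure of $\sigma\in S_\infty$ is the non-increasing sequence of lengths of the disjoint cycles of $\sigma$. The cyclicity level of a finite solvable group $G$ is the minimal $k$ such that there is a chain $1=H_0\lhd H_1\lhd\cdots\lhd H_k=G$ with each $H_i$ normal in $H_{i+1}$ and $H_{i+1}/H_i$ cyclic. -}

module Defs where

open import Level using (0ℓ)
open import Algebra.Bundles using (Group)
open import Data.Nat using (ℕ; zero; suc; _≤_; _<_)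
open import Data.Integer using (ℤ; +_; -[1+_])
open import Data.Fin using (Fin; zero; suc; fromℕ; inject₁)
open import Data.List using (List; []; _∷_; _∷ʳ_; length; map; concat)
open import Data.List.Relation.Unary.All using (All)
open import Data.List.Relation.Unary.Linked using (Linked)
open import Data.List.Relation.Unary.Unique.Propositional using (Unique)
open import Data.List.Membership.Propositional using (_∈_)
open import Data.List.Relation.Binary.Permutation.Propositional using (_↭_)
open import Data.Product using (Σ; ∃; _×_; _,_)
open import Relation.Binary.PropositionalEquality using (_≡_)
open import Relation.Nullary using (¬_)
open import Data.Empty using (⊥)

-- S_∞ : permutations of ℕ fixing all but finitely many points

record Perm : Set where
  field
    fun     : ℕ → ℕ
    inv     : ℕ → ℕ
    inv-fun : ∀ n → inv (fun n) ≡ n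
    fun-inv : ∀ n → fun (inv n) ≡ n
    bound   : ℕ
    fixes   : ∀ n → bound ≤ n → fun n ≡ n

open Perm public

_≈ₚ_ : Perm → Perm → Set
σ ≈ₚ τ = ∀ n → fun σ n ≡ fun τ n

IsCycle : (ℕ → ℕ) → List ℕ → Set
IsCycle f []           = ⊥
IsCycle f (a ∷ [])     = ⊥
IsCycle f (a ∷ b ∷ as) =
  Linked (λ u v → f u ≡ v) ((a ∷ b ∷ as) ∷ʳ a) × Unique (a ∷ b ∷ as)

record CycleDecomposition (σ : Perm) (cs : List (List ℕ)) : Set where
  field
    cycles   : All (IsCycle (fun σ)) cs
    disjoint : Unique (concat cs)
    covers   : ∀ m → ¬ (fun σ m ≡ m) → m ∈ concat cs

CycleStructure : Perm → List ℕ → Set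
CycleStructure σ x =
  Σ (List (List ℕ)) λ cs →
    CycleDecomposition σ cs × (map length cs ↭ x) × Linked (λ a b → b ≤ a) x

module _ (G : Group 0ℓ 0ℓ) where
  open Group G

  _^ℕ_ : Carrier → ℕ → Carrier
  g ^ℕ zero  = ε
  g ^ℕ suc n = g ∙ (g ^ℕ n)

  _^ℤ_ : Carrier → ℤ → Carrier
  g ^ℤ (+ n)     = g ^ℕ n
  g ^ℤ (-[1+ n ]) = (g ⁻¹) ^ℕ suc n

  IsFiniteGroup : Set
  IsFiniteGroup = Σ ℕ λ n → Σ (Fin n → Carrier) λ f → ∀ x → ∃ λ i → f i ≈ x

  record IsSubgroup (H : Carrier → Set) : Set where
    field
      resp : ∀ {x y} → x ≈ y → H x → H y
      ε∈   : H ε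
      ∙∈   : ∀ {x y} → H x → H y → H (x ∙ y)
      ⁻¹∈  : ∀ {x} → H x → H (x ⁻¹)

  IsNormalIn : (H K : Carrier → Set) → Set
  IsNormalIn H K =
    (∀ x → H x → K x) × (∀ g h → K g → H h → H ((g ∙ h) ∙ (g ⁻¹)))

  CyclicQuotient : (H K : Carrier → Set) → Set
  CyclicQuotient H K =
    Σ Carrier λ g → K g × (∀ x → K x → ∃ λ (n : ℤ) → H (((g ^ℤ n) ⁻¹) ∙ x))

  record CyclicSeries (k : ℕ) : Set₁ where
    field
      H        : Fin (suc k) → Carrier → Set
      subgroup : ∀ i → IsSubgroup (H i)
      bottom   : ∀ x → H zero x → x ≈ ε
      top      : ∀ x → H (fromℕ k) x
      normal   : ∀ (i : Fin k) → IsNormalIn (H (inject₁ i)) (H (suc i))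
      cyclic   : ∀ (i : Fin k) → CyclicQuotient (H (inject₁ i)) (H (suc i))

  HasCyclicityLevel : ℕ → Set₁
  HasCyclicityLevel k = CyclicSeries k × (∀ j → j < k → ¬ CyclicSeries j)

  record IsInjectiveHom (φ : Carrier → Perm) : Set where
    field
      cong-φ : ∀ {x y} → x ≈ y → φ x ≈ₚ φ y
      hom    : ∀ x y n → fun (φ (x ∙ y)) n ≡ fun (φ x) (fun (φ y) n)
      inj    : ∀ {x y} → φ x ≈ₚ φ y → x ≈ y

  InImage : (Carrier → Perm) → Perm → Set
  InImage φ p = ∃ λ g → φ g ≈ₚ p

-- Let s = sum x, the number of points moved by a permutation of cycle type x, and call g ∈ G
-- small when φ g moves at most s points. A small element has order dividing s!, since every
-- orbit of φ g has length at most s, and g⁻¹h moves at most 2s points when g and h are small.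
-- Along a series 1 = H₀ ⊲ ⋯ ⊲ H_k = G with cyclic factors, count the small elements of H_{i+1}
-- coset by coset: their images in the cyclic group H_{i+1}/H_i have order dividing s!, so they
-- meet at most s! cosets of H_i, and two of them in the same coset differ by an element of H_i
-- moving at most 2s points. So G has at most countBound k s small elements.

{-# OPTIONS --safe #-}
module Submission where

open import Defs
open import Level using (0ℓ)
open import Algebra.Bundles using (Group)
open import Data.Bool using (true; false)
open import Data.Empty using (⊥-elim)
open import Data.Fin using (Fin; zero; suc; toℕ; fromℕ; inject₁)
open import Data.Fin.Properties using (pigeonhole; toℕ<n; toℕ-fromℕ; toℕ-inject₁)
import Data.Integer as ℤ
open import Data.List using (List; []; _∷_; length; map; concat; filter; foldr; lookup; _++_)
open import Data.List.Properties using (length-++)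
open import Data.List.Membership.Propositional using (_∈_)
open import Data.List.Membership.Propositional.Properties using (∈-++⁺ˡ; ∈-++⁺ʳ)
open import Data.List.Relation.Unary.Any using (index)
open import Data.List.Relation.Unary.Any.Properties using (lookup-index)
open import Data.List.Relation.Unary.All as All using (All; []; _∷_)
open import Data.List.Relation.Unary.All.Properties using (all-filter)
import Data.List.Relation.Unary.All.Properties as All
open import Data.List.Relation.Unary.AllPairs using (AllPairs; []; _∷_)
import Data.List.Relation.Unary.AllPairs.Properties as AllPairs
open import Data.List.Relation.Binary.Sublist.Propositional.Properties
  using (filter-⊆; length-mono-≤) renaming (filter⁺ to filter-⊆-filter)
open import Data.Nat using (ℕ; zero; suc; _+_; _*_; _≤_; _<_; _!; _≟_; z≤n; s≤s; NonZero; ≢-nonZero)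
open import Data.Nat.Properties
  using (≤-refl; ≤-reflexive; ≤-trans; ≤∧≢⇒<; m<1+n⇒m≤n; m+n≤o⇒n≤o; m≤n⇒∃[o]m+o≡n; +-suc; +-comm; +-mono-≤;
         *-comm; *-distribˡ-+; *-cancelˡ-≡; *-monoʳ-<; suc-injective; 1+n≢0; _!≢0; module ≤-Reasoning)
open import Data.Nat.Divisibility
  using (_∣_; divides; ∣-refl; ∣-trans; 1∣_; n∣m*n; ∣m+n∣m⇒∣n; 0∣⇒≡0; m≤n⇒m!∣n!)
open import Data.Nat.DivMod using (_/_; _%_; m≡m%n+[m/n]*n; m%n<n; m/n*n≡m; m<n*o⇒m/o<n)
open import Data.Nat.GCD using (gcd; gcd-GCD; gcd[m,n]∣m; gcd[m,n]∣n; module Bézout)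
open import Data.Nat.GeneralisedArithmetic using (fold; fold-+)
open import Data.Nat.ListAction using (sum)
open import Data.Nat.ListAction.Properties using (sum-↭)
open import Data.Product using (∃; ∃₂; _×_; _,_; proj₁; proj₂; map₂)
open import Function using (_∘_; _on_)
open import Relation.Binary.PropositionalEquality as ≡ using (_≡_; _≢_)
open import Relation.Nullary using (¬_; does; yes; no)
open import Relation.Unary using (Pred; Decidable; _∩_)
open import Relation.Unary.Properties using (∁?)

module _ {A : Set} where

  length-concat : (xss : List (List A)) → length (concat xss) ≡ sum (map length xss)
  length-concat []         = ≡.refl
  length-concat (xs ∷ xss) = ≡.trans (length-++ xs) (≡.cong (length xs +_) (length-concat xss))

  length-filter-split : {P : Pred A 0ℓ} (P? : Decidable P) (xs : List A) →
    length xs ≡ length (filter P? xs) + length (filter (∁? P?) xs)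
  length-filter-split P? []       = ≡.refl
  length-filter-split P? (x ∷ xs) with does (P? x)
  ... | true  = ≡.cong suc (length-filter-split P? xs)
  ... | false = ≡.trans (≡.cong suc (length-filter-split P? xs)) (≡.sym (+-suc _ _))

  length≤fibres : (key : A → ℕ) (L B : ℕ) (xs : List A) → All (λ x → key x < L) xs →
    (∀ v → length (filter (λ x → key x ≟ v) xs) ≤ B) → length xs ≤ L * B
  length≤fibres key zero    B []      _          _      = z≤n
  length≤fibres key zero    B (_ ∷ _) (() ∷ _)   _
  length≤fibres key (suc L) B xs      keys<1+L   fibre≤B = begin
    length xs                              ≡⟨ length-filter-split atL xs ⟩
    length (filter atL xs) + length rest   ≤⟨ +-mono-≤ (fibre≤B L)
                                                 (length≤fibres key L B rest keys<L rest-fibre≤B) ⟩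
    B + L * B                              ∎
    where
    open ≤-Reasoning
    atL = λ x → key x ≟ L
    rest = filter (∁? atL) xs
    keys<L : All (λ x → key x < L) rest
    keys<L = All.zipWith (λ (k<1+L , k≢L) → ≤∧≢⇒< (m<1+n⇒m≤n k<1+L) k≢L)
               (All.filter⁺ (∁? atL) keys<1+L , all-filter (∁? atL) xs)
    rest-fibre≤B : ∀ v → length (filter (λ x → key x ≟ v) rest) ≤ B
    rest-fibre≤B v = ≤-trans
      (length-mono-≤ (filter-⊆-filter (λ x → key x ≟ v) (λ x → key x ≟ v) (λ { ≡.refl p → p })
                                      (filter-⊆ (∁? atL) xs)))
      (fibre≤B v)

module _ {A B : Set} {P : A → Set} (f : ∀ {x} → P x → B) where

  length-reduce : ∀ {xs} (pxs : All P xs) → length (All.reduce f pxs) ≡ length xs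
  length-reduce []         = ≡.refl
  length-reduce (_ ∷ pxs)  = ≡.cong suc (length-reduce pxs)

  AllPairs-reduce : {R : A → A → Set} {S : B → B → Set} →
    (∀ {x y} (px : P x) (py : P y) → R x y → S (f px) (f py)) →
    ∀ {xs} (pxs : All P xs) → AllPairs R xs → AllPairs S (All.reduce f pxs)
  AllPairs-reduce {R} {S} R⇒S = go
    where
    head : ∀ {x ys} (px : P x) (pys : All P ys) → All (R x) ys → All (S (f px)) (All.reduce f pys)
    head px []         []          = []
    head px (py ∷ pys) (Rxy ∷ Rxs) = R⇒S px py Rxy ∷ head px pys Rxs
    go : ∀ {xs} (pxs : All P xs) → AllPairs R xs → AllPairs S (All.reduce f pxs)
    go []         []           = []
    go (px ∷ pxs) (Rxs ∷ Rpxs) = head px pxs Rxs ∷ go pxs Rpxs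

pigeonhole-ℕ : ∀ n (c : ℕ → Fin n) → ∃₂ λ i e → i + suc e ≤ n × c i ≡ c (i + suc e)
pigeonhole-ℕ n c with i , j , i<j , ci≡cj ← pigeonhole ≤-refl (c ∘ toℕ)
  with o , 1+i+o≡j ← m≤n⇒∃[o]m+o≡n i<j =
  toℕ i , o , ≡.subst (_≤ n) j≡i+1+o (m<1+n⇒m≤n (toℕ<n j)) ,
  ≡.subst (λ t → c (toℕ i) ≡ c t) j≡i+1+o ci≡cj
  where
  j≡i+1+o : toℕ j ≡ toℕ i + suc o
  j≡i+1+o = ≡.trans (≡.sym 1+i+o≡j) (≡.sym (+-suc (toℕ i) o))

∣-factorial : ∀ {d s} → suc d ≤ s → suc d ∣ s !
∣-factorial {d} d<s = ∣-trans (divides (d !) (*-comm (suc d) (d !))) (m≤n⇒m!∣n! d<s)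

/-injective : ∀ {m n A} .{{_ : NonZero A}} → A ∣ m → A ∣ n → m / A ≡ n / A → m ≡ n
/-injective {m} {n} {A} A∣m A∣n m/A≡n/A = begin
  m          ≡⟨ m/n*n≡m A∣m ⟨
  m / A * A  ≡⟨ ≡.cong (_* A) m/A≡n/A ⟩
  n / A * A  ≡⟨ m/n*n≡m A∣n ⟩
  n          ∎
  where open ≡.≡-Reasoning

fold-periodic : ∀ {A : Set} (f : A → A) {x d n} → fold x f d ≡ x → d ∣ n → fold x f n ≡ x
fold-periodic f {x} {d} ret (divides q ≡.refl) = go q
  where
  go : ∀ q → fold x f (q * d) ≡ x
  go zero    = ≡.refl
  go (suc q) = begin
    fold x f (d + q * d)        ≡⟨ fold-+ x f d ⟩
    fold (fold x f (q * d)) f d ≡⟨ ≡.cong (λ y → fold y f d) (go q) ⟩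
    fold x f d                  ≡⟨ ret ⟩
    x                           ∎
    where open ≡.≡-Reasoning

record MovesAtMost (s : ℕ) (p : Perm) : Set where
  constructor support
  field
    points  : List ℕ
    bounded : length points ≤ s
    covers  : ∀ m → fun p m ≢ m → m ∈ points

movesAtMost-≈ₚ : ∀ {s p q} → p ≈ₚ q → MovesAtMost s q → MovesAtMost s p
movesAtMost-≈ₚ p≈q (support S |S|≤s covers) =
  support S |S|≤s λ m moved → covers m (moved ∘ ≡.trans (p≈q m))

cycleStructure⇒movesAtMost : ∀ {p x} → CycleStructure p x → MovesAtMost (sum x) p
cycleStructure⇒movesAtMost (cs , decomposition , lengths↭x , _) =
  support (concat cs) (≤-reflexive (≡.trans (length-concat cs) (sum-↭ lengths↭x)))
          (CycleDecomposition.covers decomposition)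

module _ (p : Perm) where

  fun-injective : ∀ {m n} → fun p m ≡ fun p n → m ≡ n
  fun-injective {m} {n} eq = ≡.trans (≡.sym (inv-fun p m)) (≡.trans (≡.cong (inv p) eq) (inv-fun p n))

  fold-injective : ∀ i {m n} → fold m (fun p) i ≡ fold n (fun p) i → m ≡ n
  fold-injective zero    eq = eq
  fold-injective (suc i) eq = fold-injective i (fun-injective eq)

  fold-moved : ∀ {m} i → fun p m ≢ m → fun p (fold m (fun p) i) ≢ fold m (fun p) i
  fold-moved zero    moved    = moved
  fold-moved (suc i) moved eq = fold-moved i moved (fun-injective eq)

  orbit⊆support : ∀ {S m} → (∀ n → fun p n ≢ n → n ∈ S) → fun p m ≢ m → ∀ i → fold m (fun p) i ∈ S
  orbit⊆support covers moved i = covers _ (fold-moved i moved)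

  period-∣! : ∀ {s} → MovesAtMost s p → ∀ m → ∃ λ d → d ∣ s ! × fold m (fun p) d ≡ m
  period-∣! {s} (support S |S|≤s covers) m with fun p m ≟ m
  ... | yes fixed = 1 , 1∣ (s !) , fixed
  ... | no  moved
    with i , e , i+1+e≤|S| , same-slot ← pigeonhole-ℕ (length S) (index ∘ orbit⊆support covers moved) =
    suc e , ∣-factorial (≤-trans (m+n≤o⇒n≤o i i+1+e≤|S|) |S|≤s) , fold-injective i returns
    where
    returns : fold (fold m (fun p) (suc e)) (fun p) i ≡ fold m (fun p) i
    returns = begin
      fold (fold m (fun p) (suc e)) (fun p) i ≡⟨ fold-+ m (fun p) i ⟨
      fold m (fun p) (i + suc e)              ≡⟨ lookup-index (orbit (i + suc e)) ⟩
      lookup S (index (orbit (i + suc e)))    ≡⟨ ≡.cong (lookup S) same-slot ⟨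
      lookup S (index (orbit i))              ≡⟨ lookup-index (orbit i) ⟨
      fold m (fun p) i                        ∎
      where
      open ≡.≡-Reasoning
      orbit = orbit⊆support covers moved

  fold-! : ∀ {s} → MovesAtMost s p → ∀ m → fold m (fun p) (s !) ≡ m
  fold-! small m with d , d∣s! , returns ← period-∣! small m = fold-periodic (fun p) returns d∣s!

module GroupFacts (G : Group 0ℓ 0ℓ) where

  open Group G
  open import Algebra.Properties.Group G
  open import Algebra.Properties.Monoid.Mult monoid using (×-congʳ; ×-homo-+; ×-assocˡ)
    renaming (_×_ to _·_)
  open import Relation.Binary.Reasoning.Setoid setoid

  -- g ^ n unfolds to the monoid multiple n · g, so Algebra.Properties.Monoid.Mult applies to it.
  infixr 8 _^_
  _^_ : Carrier → ℕ → Carrier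
  g ^ n = n · g

  ^ℕ≡^ : ∀ g n → _^ℕ_ G g n ≡ g ^ n
  ^ℕ≡^ g zero    = ≡.refl
  ^ℕ≡^ g (suc n) = ≡.cong (g ∙_) (^ℕ≡^ g n)

  IsTorsion : Set
  IsTorsion = ∀ g → ∃ λ e → g ^ suc e ≈ ε

  finite⇒torsion : IsFiniteGroup G → IsTorsion
  finite⇒torsion (n , enum , onto) g
    with i , e , _ , same ← pigeonhole-ℕ n (λ i → proj₁ (onto (g ^ i))) =
    e , ∙-cancelˡ (g ^ i) _ _ (begin
      g ^ i ∙ g ^ suc e   ≈⟨ ×-homo-+ g i (suc e) ⟨
      g ^ (i + suc e)     ≈⟨ proj₂ (onto _) ⟨
      enum _              ≡⟨ ≡.cong enum same ⟨
      enum _              ≈⟨ proj₂ (onto _) ⟩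
      g ^ i               ≈⟨ identityʳ (g ^ i) ⟨
      g ^ i ∙ ε           ∎)

  ^ℤ-as-^ : ∀ {g} → (∃ λ e → g ^ suc e ≈ ε) → ∀ z → ∃ λ r → _^ℤ_ G g z ≈ g ^ r
  ^ℤ-as-^ {g} _ (ℤ.+ n) = n , reflexive (^ℕ≡^ g n)
  ^ℤ-as-^ {g} (e , g^[1+e]≈ε) ℤ.-[1+ n ] = suc n * e , (begin
    _^ℕ_ G (g ⁻¹) (suc n) ≡⟨ ^ℕ≡^ (g ⁻¹) (suc n) ⟩
    (g ⁻¹) ^ suc n        ≈⟨ ×-congʳ (suc n) (inverseʳ-unique g (g ^ e) g^[1+e]≈ε) ⟨
    (g ^ e) ^ suc n       ≈⟨ ×-assocˡ g (suc n) e ⟩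
    g ^ (suc n * e)       ∎)

  \\-\\-cancel : ∀ c x y → (c \\ x) \\ (c \\ y) ≈ x \\ y
  \\-\\-cancel c x y = begin
    (c ⁻¹ ∙ x) ⁻¹ ∙ (c ⁻¹ ∙ y)    ≈⟨ ∙-congʳ (⁻¹-anti-homo-∙ (c ⁻¹) x) ⟩
    (x ⁻¹ ∙ c ⁻¹ ⁻¹) ∙ (c ⁻¹ ∙ y) ≈⟨ ∙-congʳ (∙-congˡ (⁻¹-involutive c)) ⟩
    (x ⁻¹ ∙ c) ∙ (c ⁻¹ ∙ y)       ≈⟨ assoc (x ⁻¹) c (c ⁻¹ ∙ y) ⟩
    x ⁻¹ ∙ (c ∙ (c ⁻¹ ∙ y))       ≈⟨ ∙-congˡ (\\-leftDividesˡ c y) ⟩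
    x ⁻¹ ∙ y                      ∎

  ∙-\\-shift : ∀ a b g → b ∙ (a ∙ b \\ g) ≈ a \\ g
  ∙-\\-shift a b g = begin
    b ∙ ((a ∙ b) ⁻¹ ∙ g)        ≈⟨ ∙-congˡ (∙-congʳ (⁻¹-anti-homo-∙ a b)) ⟩
    b ∙ ((b ⁻¹ ∙ a ⁻¹) ∙ g)     ≈⟨ ∙-congˡ (assoc (b ⁻¹) (a ⁻¹) g) ⟩
    b ∙ (b ⁻¹ ∙ (a ⁻¹ ∙ g))     ≈⟨ \\-leftDividesˡ b (a ⁻¹ ∙ g) ⟩
    a ⁻¹ ∙ g                    ∎

  ^-closed : ∀ {N g} → IsSubgroup G N → ∀ n → N g → N (g ^ n)
  ^-closed N≤G zero    _   = IsSubgroup.ε∈ N≤G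
  ^-closed N≤G (suc n) g∈N = IsSubgroup.∙∈ N≤G g∈N (^-closed N≤G n g∈N)

  module _ {N : Carrier → Set} (N≤G : IsSubgroup G N) where
    open IsSubgroup N≤G

    coset-\\ : ∀ {c x y} → N (c \\ x) → N (c \\ y) → N (x \\ y)
    coset-\\ {c} {x} {y} c\\x∈N c\\y∈N = resp (\\-\\-cancel c x y) (∙∈ (⁻¹∈ c\\x∈N) c\\y∈N)

    coset-shift : ∀ {a b g} → N b → N (a ∙ b \\ g) → N (a \\ g)
    coset-shift {a} {b} {g} b∈N ab\\g∈N = resp (∙-\\-shift a b g) (∙∈ b∈N ab\\g∈N)

    module _ {Q : Carrier → Set} (Q≤G : IsSubgroup G Q) (N⊴Q : IsNormalIn G N Q) where

      conjugate-closed : ∀ {c n} → Q c → N n → N (c ⁻¹ ∙ n ∙ c)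
      conjugate-closed {c} {n} c∈Q n∈N =
        resp (∙-congˡ (⁻¹-involutive c)) (proj₂ N⊴Q (c ⁻¹) n (IsSubgroup.⁻¹∈ Q≤G c∈Q) n∈N)

      ^-normal : ∀ {c n} → Q c → N n → ∀ L → ∃ λ n′ → N n′ × (c ∙ n) ^ L ≈ c ^ L ∙ n′
      ^-normal _ _ zero = ε , ε∈ , sym (identityˡ ε)
      ^-normal {c} {n} c∈Q n∈N (suc L) with n′ , n′∈N , [cn]^L≈c^Ln′ ← ^-normal c∈Q n∈N L =
        m ∙ n′ , ∙∈ m∈N n′∈N , (begin
          (c ∙ n) ∙ (c ∙ n) ^ L                    ≈⟨ ∙-congˡ [cn]^L≈c^Ln′ ⟩
          (c ∙ n) ∙ (cᴸ ∙ n′)                      ≈⟨ assoc c n (cᴸ ∙ n′) ⟩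
          c ∙ (n ∙ (cᴸ ∙ n′))                      ≈⟨ ∙-congˡ (\\-leftDividesˡ cᴸ _) ⟨
          c ∙ (cᴸ ∙ (cᴸ ⁻¹ ∙ (n ∙ (cᴸ ∙ n′))))     ≈⟨ assoc c cᴸ _ ⟨
          (c ∙ cᴸ) ∙ (cᴸ ⁻¹ ∙ (n ∙ (cᴸ ∙ n′)))     ≈⟨ ∙-congˡ (∙-congˡ (assoc n cᴸ n′)) ⟨
          (c ∙ cᴸ) ∙ (cᴸ ⁻¹ ∙ ((n ∙ cᴸ) ∙ n′))     ≈⟨ ∙-congˡ (assoc (cᴸ ⁻¹) (n ∙ cᴸ) n′) ⟨
          (c ∙ cᴸ) ∙ ((cᴸ ⁻¹ ∙ (n ∙ cᴸ)) ∙ n′)     ≈⟨ ∙-congˡ (∙-congʳ (assoc (cᴸ ⁻¹) n cᴸ)) ⟨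
          (c ∙ cᴸ) ∙ (m ∙ n′)                      ∎)
        where
        cᴸ = c ^ L
        m = cᴸ ⁻¹ ∙ n ∙ cᴸ
        m∈N : N m
        m∈N = conjugate-closed (^-closed Q≤G L c∈Q) n∈N

      order-mod-normal : ∀ {c g} L → Q c → N (c \\ g) → g ^ L ≈ ε → N (c ^ L)
      order-mod-normal {c} {g} L c∈Q c\\g∈N g^L≈ε
        with n′ , n′∈N , [c[c\\g]]^L≈c^Ln′ ← ^-normal c∈Q c\\g∈N L =
        resp (sym (inverseˡ-unique (c ^ L) n′ c^Ln′≈ε)) (⁻¹∈ n′∈N)
        where
        c^Ln′≈ε : c ^ L ∙ n′ ≈ ε
        c^Ln′≈ε = begin
          c ^ L ∙ n′           ≈⟨ [c[c\\g]]^L≈c^Ln′ ⟨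
          (c ∙ (c \\ g)) ^ L   ≈⟨ ×-congʳ L (\\-leftDividesˡ c g) ⟩
          g ^ L                ≈⟨ g^L≈ε ⟩
          ε                    ∎

    module Exponents (γ : Carrier) where

      Annihilates : ℕ → Set
      Annihilates m = N (γ ^ m)

      annihilates-* : ∀ q {m} → Annihilates m → Annihilates (q * m)
      annihilates-* q {m} γᵐ∈N = resp (×-assocˡ γ q m) (^-closed N≤G q γᵐ∈N)

      annihilates-∸ : ∀ {a b d} → d + b ≡ a → Annihilates a → Annihilates b → Annihilates d
      annihilates-∸ {a} {b} {d} d+b≡a γᵃ∈N γᵇ∈N = resp (sym γᵈ≈γᵃ//γᵇ) (∙∈ γᵃ∈N (⁻¹∈ γᵇ∈N))
        where
        γᵈ≈γᵃ//γᵇ : γ ^ d ≈ γ ^ a // γ ^ b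
        γᵈ≈γᵃ//γᵇ = x≈z//y (γ ^ d) (γ ^ b) (γ ^ a)
          (trans (sym (×-homo-+ γ d b)) (reflexive (≡.cong (γ ^_) d+b≡a)))

      annihilates-gcd : ∀ {m n} → Annihilates m → Annihilates n → Annihilates (gcd m n)
      annihilates-gcd {m} {n} γᵐ∈N γⁿ∈N with Bézout.identity (gcd-GCD m n)
      ... | Bézout.+- x y eq =
        annihilates-∸ {x * m} {y * n} {gcd m n} eq (annihilates-* x γᵐ∈N) (annihilates-* y γⁿ∈N)
      ... | Bézout.-+ x y eq =
        annihilates-∸ {y * n} {x * m} {gcd m n} eq (annihilates-* y γⁿ∈N) (annihilates-* x γᵐ∈N)

  record Size : Set₁ where
    field
      Small       : ℕ → Carrier → Set
      small-order : ∀ {s g} → Small s g → g ^ (s !) ≈ ε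
      small-\\    : ∀ {s t g h} → Small s g → Small t h → Small (s + t) (g \\ h)

  AtMost : ℕ → (Carrier → Set) → Set
  AtMost B P = (xs : List (∃ P)) → AllPairs (_≉_ on proj₁) xs → length xs ≤ B

  data HasCyclicSeries : ℕ → (Carrier → Set) → Set₁ where
    trivial : ∀ {Q} → (∀ x → Q x → x ≈ ε) → HasCyclicSeries zero Q
    extend  : ∀ {k N Q} → IsSubgroup G N → IsSubgroup G Q → IsNormalIn G N Q → CyclicQuotient G N Q →
              HasCyclicSeries k N → HasCyclicSeries (suc k) Q

  cyclicSeries⇒hasCyclicSeries : ∀ {k} (cs : CyclicSeries G k) →
    HasCyclicSeries k (CyclicSeries.H cs (fromℕ k))
  cyclicSeries⇒hasCyclicSeries {k} cs = at-level k (fromℕ k) (toℕ-fromℕ k)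
    where
    open CyclicSeries cs
    at-level : ∀ n i → toℕ i ≡ n → HasCyclicSeries n (H i)
    at-level zero    zero    _  = trivial bottom
    at-level (suc n) (suc i) eq = extend (subgroup (inject₁ i)) (subgroup (suc i)) (normal i) (cyclic i)
      (at-level n (inject₁ i) (≡.trans (toℕ-inject₁ i) (suc-injective eq)))

module Embedding (G : Group 0ℓ 0ℓ) (φ : Group.Carrier G → Perm) (φ-hom : IsInjectiveHom G φ) where

  open Group G
  open GroupFacts G
  open IsInjectiveHom φ-hom

  φ-ε : ∀ m → fun (φ ε) m ≡ m
  φ-ε m = fun-injective (φ ε) (≡.trans (≡.sym (hom ε ε m)) (cong-φ (identityˡ ε) m))

  φ-^ : ∀ g i m → fun (φ (g ^ i)) m ≡ fold m (fun (φ g)) i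
  φ-^ g zero    m = φ-ε m
  φ-^ g (suc i) m = ≡.trans (hom g (g ^ i) m) (≡.cong (fun (φ g)) (φ-^ g i m))

  fixed⇒⁻¹-fixed : ∀ {g m} → fun (φ g) m ≡ m → fun (φ (g ⁻¹)) m ≡ m
  fixed⇒⁻¹-fixed {g} {m} fixed = begin
    fun (φ (g ⁻¹)) m            ≡⟨ ≡.cong (fun (φ (g ⁻¹))) fixed ⟨
    fun (φ (g ⁻¹)) (fun (φ g) m) ≡⟨ hom (g ⁻¹) g m ⟨
    fun (φ (g ⁻¹ ∙ g)) m        ≡⟨ cong-φ (inverseˡ g) m ⟩
    fun (φ ε) m                 ≡⟨ φ-ε m ⟩
    m                           ∎
    where open ≡.≡-Reasoning

  size : Size
  size = record
    { Small       = λ s g → MovesAtMost s (φ g)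
    ; small-order = small-order
    ; small-\\    = small-\\
    }
    where
    small-order : ∀ {s g} → MovesAtMost s (φ g) → g ^ (s !) ≈ ε
    small-order {s} {g} small = inj λ m → begin
      fun (φ (g ^ (s !))) m      ≡⟨ φ-^ g (s !) m ⟩
      fold m (fun (φ g)) (s !)   ≡⟨ fold-! (φ g) small m ⟩
      m                          ≡⟨ φ-ε m ⟨
      fun (φ ε) m                ∎
      where open ≡.≡-Reasoning
    small-\\ : ∀ {s t g h} → MovesAtMost s (φ g) → MovesAtMost t (φ h) → MovesAtMost (s + t) (φ (g \\ h))
    small-\\ {g = g} {h} (support S |S|≤s S-covers) (support T |T|≤t T-covers) =
      support (S ++ T) (≡.subst (_≤ _) (≡.sym (length-++ S)) (+-mono-≤ |S|≤s |T|≤t)) covers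
      where
      covers : ∀ m → fun (φ (g \\ h)) m ≢ m → m ∈ S ++ T
      covers m moved with fun (φ h) m ≟ m
      ... | no  h-moves = ∈-++⁺ʳ S (T-covers m h-moves)
      ... | yes h-fixes = ∈-++⁺ˡ (S-covers m λ g-fixes →
            moved (≡.trans (hom (g ⁻¹) h m)
                           (≡.trans (≡.cong (fun (φ (g ⁻¹))) h-fixes) (fixed⇒⁻¹-fixed g-fixes))))

  images-atMost : ∀ {Q B s} → (∀ g → Q g) → AtMost B (Q ∩ (λ g → MovesAtMost s (φ g))) →
    (ps : List Perm) → All (λ p → InImage G φ p × MovesAtMost s p) ps →
    AllPairs (λ p q → ¬ (p ≈ₚ q)) ps → length ps ≤ B
  images-atMost {Q} {B} {s} everywhere atMost ps images distinct =
    ≡.subst (_≤ B) (length-reduce (λ {p} → preimage {p}) images)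
      (atMost _ (AllPairs-reduce (λ {p} → preimage {p}) {S = _≉_ on proj₁} distinct⇒≉ images distinct))
    where
    Image : Perm → Set
    Image p = InImage G φ p × MovesAtMost s p
    preimage : ∀ {p} → Image p → ∃ (Q ∩ (λ g → MovesAtMost s (φ g)))
    preimage ((g , φg≈p) , small) = g , everywhere g , movesAtMost-≈ₚ φg≈p small
    distinct⇒≉ : ∀ {p q} (x : Image p) (y : Image q) →
      ¬ (p ≈ₚ q) → proj₁ (preimage {p} x) ≉ proj₁ (preimage {q} y)
    distinct⇒≉ ((g , φg≈p) , _) ((h , φh≈q) , _) p≉q g≈h =
      p≉q λ m → ≡.trans (≡.sym (φg≈p m)) (≡.trans (cong-φ g≈h m) (φh≈q m))

countBound : ℕ → ℕ → ℕ
countBound zero    s = 1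
countBound (suc k) s = s ! * countBound k (s + s)

module Counting (G : Group 0ℓ 0ℓ) (torsion : GroupFacts.IsTorsion G) (size : GroupFacts.Size G) where

  open Group G
  open GroupFacts G
  open Size size
  open import Algebra.Properties.Group G using (∙-cancelˡ)
  open import Algebra.Properties.Monoid.Mult monoid using (×-homo-+; ×-assocˡ)

  atMost-trivial : ∀ {Q P} → (∀ x → Q x → x ≈ ε) → AtMost 1 (Q ∩ P)
  atMost-trivial _    []          _ = z≤n
  atMost-trivial _    (_ ∷ [])    _ = ≤-refl
  atMost-trivial Q≈ε ((x , x∈Q , _) ∷ (y , y∈Q , _) ∷ _) ((x≉y ∷ _) ∷ _) =
    ⊥-elim (x≉y (trans (Q≈ε x x∈Q) (sym (Q≈ε y y∈Q))))

  module Extension {N Q : Carrier → Set} (N≤G : IsSubgroup G N) (Q≤G : IsSubgroup G Q)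
    (N⊴Q : IsNormalIn G N Q) (Q/N-cyclic : CyclicQuotient G N Q) (s B : ℕ)
    (atMost-N : AtMost B (N ∩ Small (s + s))) where

    open IsSubgroup N≤G
    γ : Carrier
    γ = proj₁ Q/N-cyclic

    open Exponents N≤G γ

    L : ℕ
    L = s !

    E : ℕ
    E = suc (proj₁ (torsion γ))

    Element : Set
    Element = ∃ (Q ∩ Small s)

    coset-exponent : ∀ {x} → Q x → ∃ λ r → N (γ ^ r \\ x)
    coset-exponent x∈Q with z , γᶻ\\x∈N ← proj₂ (proj₂ Q/N-cyclic) _ x∈Q
      with r , γᶻ≈γʳ ← ^ℤ-as-^ (torsion γ) z = r , resp (∙-congʳ (⁻¹-cong γᶻ≈γʳ)) γᶻ\\x∈N

    exponent : Element → ℕ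
    exponent (_ , x∈Q , _) = proj₁ (coset-exponent x∈Q)

    exponent-coset : ∀ x → N (γ ^ exponent x \\ proj₁ x)
    exponent-coset (_ , x∈Q , _) = proj₂ (coset-exponent x∈Q)

    annihilates-E : Annihilates E
    annihilates-E = resp (sym (proj₂ (torsion γ))) ε∈

    annihilates-L*exponent : ∀ x → Annihilates (L * exponent x)
    annihilates-L*exponent x@(_ , _ , x-small) = resp (×-assocˡ γ L (exponent x))
      (order-mod-normal N≤G Q≤G N⊴Q L (^-closed Q≤G (exponent x) (proj₁ (proj₂ Q/N-cyclic)))
        (exponent-coset x) (small-order x-small))

    -- Membership in N is undecidable, so the order of γN cannot be computed; the gcd A of E and
    -- all L · r takes its place. Then γ ^ A ∈ N and A ∣ L · r, so the coset γ ^ r N is fixed by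
    -- r mod A, and these residues are told apart by the key L · (r mod A) / A < L.
    modulus : List Element → ℕ
    modulus = foldr (λ x A → gcd (L * exponent x) A) E

    modulus-∣E : ∀ xs → modulus xs ∣ E
    modulus-∣E []       = ∣-refl
    modulus-∣E (x ∷ xs) = ∣-trans (gcd[m,n]∣n (L * exponent x) (modulus xs)) (modulus-∣E xs)

    modulus-nonZero : ∀ xs → NonZero (modulus xs)
    modulus-nonZero xs = ≢-nonZero λ A≡0 → 1+n≢0 (0∣⇒≡0 (≡.subst (_∣ E) A≡0 (modulus-∣E xs)))

    annihilates-modulus : ∀ xs → Annihilates (modulus xs)
    annihilates-modulus []       = annihilates-E
    annihilates-modulus (x ∷ xs) =
      annihilates-gcd {L * exponent x} {modulus xs} (annihilates-L*exponent x) (annihilates-modulus xs)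

    modulus-∣-L*exponent : ∀ xs → All (λ x → modulus xs ∣ L * exponent x) xs
    modulus-∣-L*exponent []       = []
    modulus-∣-L*exponent (x ∷ xs) = gcd[m,n]∣m (L * exponent x) (modulus xs)
      ∷ All.map (∣-trans (gcd[m,n]∣n (L * exponent x) (modulus xs))) (modulus-∣-L*exponent xs)

    instance
      L-nonZero : NonZero L
      L-nonZero = s !≢0

    module Residues (A : ℕ) {{A-nonZero : NonZero A}} (γᴬ∈N : Annihilates A) where

      residue : Element → ℕ
      residue x = exponent x % A

      residue-coset : ∀ x → N (γ ^ residue x \\ proj₁ x)
      residue-coset x = coset-shift N≤G (annihilates-* (exponent x / A) {A} γᴬ∈N)
        (resp (∙-congʳ (⁻¹-cong γʳ-split)) (exponent-coset x))
        where
        γʳ-split : γ ^ exponent x ≈ γ ^ residue x ∙ γ ^ (exponent x / A * A)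
        γʳ-split = trans (reflexive (≡.cong (γ ^_) (m≡m%n+[m/n]*n (exponent x) A)))
                          (×-homo-+ γ (residue x) (exponent x / A * A))

      key : Element → ℕ
      key x = L * residue x / A

      key<L : ∀ x → key x < L
      key<L x = m<n*o⇒m/o<n (*-monoʳ-< L (m%n<n (exponent x) A))

      ∣-L*residue : ∀ x → A ∣ L * exponent x → A ∣ L * residue x
      ∣-L*residue x A∣Lr = ∣m+n∣m⇒∣n (≡.subst (A ∣_) split A∣Lr) (∣-trans (n∣m*n q) (n∣m*n L))
        where
        q = exponent x / A
        split : L * exponent x ≡ L * (q * A) + L * residue x
        split = ≡.trans
          (≡.cong (L *_) (≡.trans (m≡m%n+[m/n]*n (exponent x) A) (+-comm (residue x) (q * A))))
          (*-distribˡ-+ L (q * A) (residue x))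

      same-key⇒same-coset : ∀ x y → A ∣ L * exponent x → A ∣ L * exponent y → key x ≡ key y →
        N (proj₁ x \\ proj₁ y)
      same-key⇒same-coset x y A∣x A∣y kx≡ky = coset-\\ N≤G (residue-coset x)
        (≡.subst (λ ρ → N (γ ^ ρ \\ proj₁ y)) (≡.sym ρx≡ρy) (residue-coset y))
        where
        ρx≡ρy : residue x ≡ residue y
        ρx≡ρy = *-cancelˡ-≡ (residue x) (residue y) L
                  (/-injective (∣-L*residue x A∣x) (∣-L*residue y A∣y) kx≡ky)

    atMost-coset : (c : Element) (ys : List Element) → All (λ y → N (proj₁ c \\ proj₁ y)) ys →
      AllPairs (_≉_ on proj₁) ys → length ys ≤ B
    atMost-coset (c , _ , c-small) ys c\\ys∈N distinct =
      ≡.subst (_≤ B) (length-reduce (λ {y} → translate {y}) c\\ys∈N)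
        (atMost-N _ (AllPairs-reduce (λ {y} → translate {y}) {S = _≉_ on proj₁}
          (λ {x} {y} _ _ x≉y → x≉y ∘ ∙-cancelˡ (c ⁻¹) (proj₁ x) (proj₁ y)) c\\ys∈N distinct))
      where
      InCoset : Element → Set
      InCoset y = N (c \\ proj₁ y)
      translate : ∀ {y} → InCoset y → ∃ (N ∩ Small (s + s))
      translate {y , _ , y-small} c\\y∈N = c \\ y , c\\y∈N , small-\\ c-small y-small

    atMost-extension : AtMost (L * B) (Q ∩ Small s)
    atMost-extension xs distinct = length≤fibres key L B xs (All.universal key<L xs) fibre≤B
      where
      A = modulus xs
      instance
        A-nonZero : NonZero A
        A-nonZero = modulus-nonZero xs
      open Residues A (annihilates-modulus xs)
      fibre-bound : ∀ {v} ys → All (λ y → key y ≡ v) ys → All (λ y → A ∣ L * exponent y) ys →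
        AllPairs (_≉_ on proj₁) ys → length ys ≤ B
      fibre-bound []       _                _                _         = z≤n
      fibre-bound (y ∷ ys) keys@(ky ∷ _) divs@(A∣y ∷ _) distinct′ = atMost-coset y (y ∷ ys)
        (All.zipWith (λ {z} (kz , A∣z) → same-key⇒same-coset y z A∣y A∣z (≡.trans ky (≡.sym kz)))
                     (keys , divs))
        distinct′
      fibre≤B : ∀ v → length (filter (λ x → key x ≟ v) xs) ≤ B
      fibre≤B v = fibre-bound (filter (λ x → key x ≟ v) xs) (all-filter (λ x → key x ≟ v) xs)
        (All.filter⁺ (λ x → key x ≟ v) (modulus-∣-L*exponent xs))
        (AllPairs.filter⁺ (λ x → key x ≟ v) distinct)

  atMost-tower : ∀ {k Q} → HasCyclicSeries k Q → ∀ s → AtMost (countBound k s) (Q ∩ Small s)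
  atMost-tower (trivial Q≈ε) s = atMost-trivial Q≈ε
  atMost-tower (extend N≤G Q≤G N⊴Q Q/N-cyclic series) s =
    Extension.atMost-extension N≤G Q≤G N⊴Q Q/N-cyclic s _ (atMost-tower series (s + s))

mainTheorem11 : (k : ℕ) (x : List ℕ) → (∃ λ σ → CycleStructure σ x) →
    ∃ λ (b : ℕ) → (G : Group 0ℓ 0ℓ) → IsFiniteGroup G → HasCyclicityLevel G k →
      (φ : Group.Carrier G → Perm) → IsInjectiveHom G φ →
      (ps : List Perm) → All (λ p → InImage G φ p × CycleStructure p x) ps →
      AllPairs (λ p q → ¬ (p ≈ₚ q)) ps → length ps ≤ b
mainTheorem11 k x _ = countBound k (sum x) , λ G finite (series , _) φ φ-hom ps images distinct →
  Embedding.images-atMost G φ φ-hom (CyclicSeries.top series)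
    (Counting.atMost-tower G (GroupFacts.finite⇒torsion G finite) (Embedding.size G φ φ-hom)
      (GroupFacts.cyclicSeries⇒hasCyclicSeries G series) (sum x))
    ps (All.map (map₂ cycleStructure⇒movesAtMost) images) distinct
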